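{- Let $p$ be a prime and let $G(p)$ denote the number of integers $x$ with $1 \leq x \leq (p-1)p$ and $p \nmid x$ such that $x^x \equiv x \pmod{p}$. Then $$G(p) = (p-1)\sum_{n \mid p-1} \frac{\phi(n)}{n},$$ where the sum runs over the positive divisors $n$ of $p-1$ and $\phi$ is Euler's totient function. -}

module Defs where

open import Data.Nat as ℕ using (ℕ; zero; suc; _*_; _∸_; _^_)
open import Data.Nat.Divisibility using (_∣_; _∣?_)
open import Data.Nat.Coprimality using (Coprime; coprime?)
open import Data.Integer as ℤ using (ℤ; +_)
import Data.Integer.Divisibility.Signed as ℤDiv
open import Data.Rational as ℚ using (ℚ)
open import Data.List using (List; length; filter; map; foldr; applyUpTo)
open import Data.Product using (_×_)
open import Relation.Nullary using (¬_; Dec)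
open import Relation.Nullary.Decidable using (_×-dec_; ¬?)

oneTo : ℕ → List ℕ
oneTo n = applyUpTo suc n

infix 4 _≡_[mod_] _≡?_[mod_]

_≡_[mod_] : ℕ → ℕ → ℕ → Set
a ≡ b [mod m ] = (+ m) ℤDiv.∣ ((+ a) ℤ.- (+ b))

_≡?_[mod_] : (a b m : ℕ) → Dec (a ≡ b [mod m ])
a ≡? b [mod m ] = (+ m) ℤDiv.∣? ((+ a) ℤ.- (+ b))

φ : ℕ → ℕ
φ n = length (filter (λ k → coprime? k n) (oneTo n))

GProp : ℕ → ℕ → Set
GProp p x = (¬ (p ∣ x)) × (x ^ x ≡ x [mod p ])

GProp? : (p x : ℕ) → Dec (GProp p x)
GProp? p x = ¬? (p ∣? x) ×-dec (x ^ x ≡? x [mod p ])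

G : ℕ → ℕ
G p = length (filter (GProp? p) (oneTo ((p ∸ 1) * p)))

-- φ(n)/n as a rational (n = 0 never occurs below; it is mapped to 0).
φOver : ℕ → ℚ
φOver zero    = ℚ.0ℚ
φOver (suc k) = (+ φ (suc k)) ℚ./ (suc k)

divisorSum : ℕ → ℚ
divisorSum m = foldr ℚ._+_ ℚ.0ℚ (map φOver (filter (λ n → n ∣? m) (oneTo m)))

module Submission where

-- Let p be prime and n = p - 1.  The proof establishes the chain
--     G(p) = Σ_{k<n} gcd(k, n) = Σ_{d ∣ n} (n/d)·φ(d) = n · Σ_{d ∣ n} φ(d)/d.
-- * Write x ∈ [1, n·p] as x = j·p + (t + 1) with j < n, t ≤ n.  For t = n we get p ∣ x;
--   otherwise x ≡ r = t + 1 and Fermat gives x^x ≡ r·r^(j+t), so x^x ≡ x means r^(j+t) ≡ 1.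
--   As k ↦ r^k mod p has period n, summing over j and t gives G(p) = Σ_{k<n} R(k), where
--   R(k) is the number of residues r ∈ [1, n] with r^k ≡ 1.
-- * R(k) = gcd(k, n): whether r^k ≡ 1 depends only on g = gcd(k, n) (Bézout and Fermat);
--   X^g - 1 has at most g roots modulo p (Lagrange's bound), and every unit is a root of
--   X^n - 1 = (X^g - 1)·(1 + X^g + ⋯ + X^(n-g)), whose second factor has at most n - g roots.
-- * Pillai's identity Σ_{1≤k≤N} gcd(k, N) = Σ_{d∣N} (N/d)·φ(d), grouping k by N/gcd(k, N).
-- * A computation in ℚ turns the last sum into n · Σ_{d∣n} φ(d)/d.

open import Data.Nat as ℕ using (ℕ; zero; suc; z≤n; s≤s)
open import Data.Nat.Primality using (Prime; euclidsLemma)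

module FiniteSums where

  open import Data.Nat
  open import Data.Nat.Properties
  open import Algebra.Properties.CommutativeSemigroup +-commutativeSemigroup using (interchange)
  open import Data.List using (List; []; _∷_; length; filter; applyUpTo)
  open import Data.List.Relation.Unary.All using (All; []; _∷_; lookup)
  open import Data.List.Relation.Unary.Unique.Propositional using (Unique)
  open import Data.List.Relation.Unary.AllPairs using (_∷_)
  open import Data.List.Membership.Propositional using (_∈_)
  open import Data.List.Relation.Unary.Any using (here; there)
  open import Data.Sum using (_⊎_; inj₁; inj₂)
  open import Data.Empty using (⊥-elim)
  open import Relation.Nullary using (¬_; Dec; yes; no)
  open import Relation.Binary.PropositionalEquality
  open import Function using (_∘_)
  open ≡-Reasoning

  Σ< : (ℕ → ℕ) → ℕ → ℕ
  Σ< f zero    = 0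
  Σ< f (suc n) = Σ< f n + f n

  𝟙 : ∀ {ℓ} {P : Set ℓ} → Dec P → ℕ
  𝟙 (yes _) = 1
  𝟙 (no _)  = 0

  𝟙-⇔ : ∀ {ℓ ℓ′} {P : Set ℓ} {Q : Set ℓ′} (P? : Dec P) (Q? : Dec Q) →
        (P → Q) → (Q → P) → 𝟙 P? ≡ 𝟙 Q?
  𝟙-⇔ (yes _) (yes _) _ _ = refl
  𝟙-⇔ (yes p) (no ¬q) f _ = ⊥-elim (¬q (f p))
  𝟙-⇔ (no ¬p) (yes q) _ g = ⊥-elim (¬p (g q))
  𝟙-⇔ (no _)  (no _)  _ _ = refl

  𝟙-no : ∀ {ℓ} {P : Set ℓ} (P? : Dec P) → ¬ P → 𝟙 P? ≡ 0
  𝟙-no (yes p) ¬p = ⊥-elim (¬p p)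
  𝟙-no (no _)  _  = refl

  Σ-ext : ∀ {f g} n → (∀ i → i < n → f i ≡ g i) → Σ< f n ≡ Σ< g n
  Σ-ext zero    _ = refl
  Σ-ext (suc n) h = cong₂ _+_ (Σ-ext n (λ i i<n → h i (m<n⇒m<1+n i<n))) (h n (n<1+n n))

  Σ-zero : ∀ n → Σ< (λ _ → 0) n ≡ 0
  Σ-zero zero    = refl
  Σ-zero (suc n) = cong (_+ 0) (Σ-zero n)

  Σ-cons : ∀ f n → Σ< f (suc n) ≡ f 0 + Σ< (f ∘ suc) n
  Σ-cons f zero    = +-comm 0 (f 0)
  Σ-cons f (suc n) = begin
    Σ< f (suc n) + f (suc n)           ≡⟨ cong (_+ f (suc n)) (Σ-cons f n) ⟩
    f 0 + Σ< (f ∘ suc) n + f (suc n)   ≡⟨ +-assoc (f 0) _ _ ⟩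
    f 0 + Σ< (f ∘ suc) (suc n)         ∎

  Σ-+ : ∀ f g n → Σ< (λ i → f i + g i) n ≡ Σ< f n + Σ< g n
  Σ-+ f g zero    = refl
  Σ-+ f g (suc n) = trans (cong (_+ (f n + g n)) (Σ-+ f g n)) (interchange (Σ< f n) (Σ< g n) (f n) (g n))

  Σ-*ˡ : ∀ c f n → Σ< (λ i → c * f i) n ≡ c * Σ< f n
  Σ-*ˡ c f zero    = sym (*-zeroʳ c)
  Σ-*ˡ c f (suc n) = trans (cong (_+ c * f n) (Σ-*ˡ c f n)) (sym (*-distribˡ-+ c (Σ< f n) (f n)))

  Σ-swap : ∀ (h : ℕ → ℕ → ℕ) n m → Σ< (λ i → Σ< (h i) m) n ≡ Σ< (λ j → Σ< (λ i → h i j) n) m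
  Σ-swap h zero    m = sym (Σ-zero m)
  Σ-swap h (suc n) m = begin
    Σ< (λ i → Σ< (h i) m) n + Σ< (h n) m               ≡⟨ cong (_+ Σ< (h n) m) (Σ-swap h n m) ⟩
    Σ< (λ j → Σ< (λ i → h i j) n) m + Σ< (h n) m       ≡⟨ Σ-+ (λ j → Σ< (λ i → h i j) n) (h n) m ⟨
    Σ< (λ j → Σ< (λ i → h i j) n + h n j) m            ∎

  Σ-split : ∀ f a b → Σ< f (a + b) ≡ Σ< f a + Σ< (λ i → f (a + i)) b
  Σ-split f a zero    = trans (cong (Σ< f) (+-identityʳ a)) (sym (+-identityʳ _))
  Σ-split f a (suc b) = begin
    Σ< f (a + suc b)                                  ≡⟨ cong (Σ< f) (+-suc a b) ⟩
    Σ< f (a + b) + f (a + b)                          ≡⟨ cong (_+ f (a + b)) (Σ-split f a b) ⟩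
    Σ< f a + Σ< (λ i → f (a + i)) b + f (a + b)       ≡⟨ +-assoc (Σ< f a) _ _ ⟩
    Σ< f a + Σ< (λ i → f (a + i)) (suc b)             ∎

  Σ-block : ∀ f a b → Σ< f (a * b) ≡ Σ< (λ j → Σ< (λ t → f (j * b + t)) b) a
  Σ-block f zero    b = refl
  Σ-block f (suc a) b = begin
    Σ< f (b + a * b)                                      ≡⟨ cong (Σ< f) (+-comm b (a * b)) ⟩
    Σ< f (a * b + b)                                      ≡⟨ Σ-split f (a * b) b ⟩
    Σ< f (a * b) + Σ< (λ t → f (a * b + t)) b             ≡⟨ cong (_+ Σ< (λ t → f (a * b + t)) b) (Σ-block f a b) ⟩
    Σ< (λ j → Σ< (λ t → f (j * b + t)) b) a + Σ< (λ t → f (a * b + t)) b ∎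

  Σ-rotate : ∀ f n → f n ≡ f 0 → Σ< (f ∘ suc) n ≡ Σ< f n
  Σ-rotate f n fn≡f0 = +-cancelˡ-≡ (f 0) _ _ (begin
    f 0 + Σ< (f ∘ suc) n   ≡⟨ Σ-cons f n ⟨
    Σ< f n + f n           ≡⟨ cong (Σ< f n +_) fn≡f0 ⟩
    Σ< f n + f 0           ≡⟨ +-comm (Σ< f n) (f 0) ⟩
    f 0 + Σ< f n           ∎)

  Σ-periodic : ∀ (F : ℕ → ℕ) n → (∀ k → F (k + n) ≡ F k) → ∀ c → Σ< (λ j → F (j + c)) n ≡ Σ< F n
  Σ-periodic F n per zero    = Σ-ext n (λ i _ → cong F (+-identityʳ i))
  Σ-periodic F n per (suc c) = begin
    Σ< (λ j → F (j + suc c)) n   ≡⟨ Σ-ext n (λ i _ → cong F (+-suc i c)) ⟩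
    Σ< (λ j → F (suc j + c)) n   ≡⟨ Σ-rotate (λ j → F (j + c)) n (trans (cong F (+-comm n c)) (per c)) ⟩
    Σ< (λ j → F (j + c)) n       ≡⟨ Σ-periodic F n per c ⟩
    Σ< F n                       ∎

  count : ∀ {ℓ} {A : Set} {P : A → Set ℓ} (P? : ∀ x → Dec (P x)) (f : ℕ → A) n →
          length (filter P? (applyUpTo f n)) ≡ Σ< (λ i → 𝟙 (P? (f i))) n
  count P? f zero    = refl
  count P? f (suc n) = trans head (sym (Σ-cons (λ i → 𝟙 (P? (f i))) n))
    where
    head : length (filter P? (applyUpTo f (suc n))) ≡ 𝟙 (P? (f 0)) + Σ< (λ i → 𝟙 (P? (f (suc i)))) n
    head with P? (f 0)
    ... | yes _ = cong suc (count P? (f ∘ suc) n)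
    ... | no _  = count P? (f ∘ suc) n

  count-⊎ : ∀ {ℓ ℓ′} {A : Set} {P : A → Set ℓ} {Q : A → Set ℓ′} (P? : ∀ x → Dec (P x)) (Q? : ∀ x → Dec (Q x))
            (xs : List A) → All (λ x → P x ⊎ Q x) xs → length xs ≤ length (filter P? xs) + length (filter Q? xs)
  count-⊎ P? Q? [] [] = z≤n
  count-⊎ P? Q? (x ∷ xs) (h ∷ hs) with P? x | Q? x | count-⊎ P? Q? xs hs
  ... | yes _ | yes _ | ih = s≤s (≤-trans ih (+-monoʳ-≤ (length (filter P? xs)) (n≤1+n _)))
  ... | yes _ | no _  | ih = s≤s ih
  ... | no _  | yes _ | ih = ≤-trans (s≤s ih) (≤-reflexive (sym (+-suc _ _)))
  ... | no ¬p | no ¬q | _  with h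
  ...   | inj₁ p = ⊥-elim (¬p p)
  ...   | inj₂ q = ⊥-elim (¬q q)

  ΣL : ∀ {A : Set} → List A → (A → ℕ) → ℕ
  ΣL []       w = 0
  ΣL (x ∷ xs) w = w x + ΣL xs w

  ΣL-ext : ∀ {A : Set} (D : List A) {v w : A → ℕ} → All (λ d → v d ≡ w d) D → ΣL D v ≡ ΣL D w
  ΣL-ext []      []       = refl
  ΣL-ext (d ∷ D) (e ∷ es) = cong₂ _+_ e (ΣL-ext D es)

  ΣL-swap : ∀ {A : Set} (D : List A) (h : ℕ → A → ℕ) n →
            Σ< (λ k → ΣL D (h k)) n ≡ ΣL D (λ d → Σ< (λ k → h k d) n)
  ΣL-swap []      h n = Σ-zero n
  ΣL-swap (d ∷ D) h n = trans (Σ-+ (λ k → h k d) (λ k → ΣL D (h k)) n) (cong (Σ< (λ k → h k d) n +_) (ΣL-swap D h n))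

  ΣL-pick : ∀ (D : List ℕ) (w : ℕ → ℕ) x → Unique D → x ∈ D → ΣL D (λ d → 𝟙 (x ≟ d) * w d) ≡ w x
  ΣL-pick (d ∷ D) w x (u ∷ _) (here refl) with x ≟ x
  ... | no x≢x = ⊥-elim (x≢x refl)
  ... | yes _  = trans (cong₂ _+_ (*-identityˡ (w x)) (trans (ΣL-ext D (vanish D u)) (ΣL-zero D))) (+-identityʳ (w x))
    where
    vanish : ∀ D → All (x ≢_) D → All (λ y → 𝟙 (x ≟ y) * w y ≡ 0) D
    vanish []      []         = []
    vanish (y ∷ D) (ne ∷ nes) = cong (_* w y) (𝟙-no (x ≟ y) ne) ∷ vanish D nes
    ΣL-zero : ∀ D → ΣL D (λ _ → 0) ≡ 0
    ΣL-zero []      = refl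
    ΣL-zero (_ ∷ D) = ΣL-zero D
  ΣL-pick (d ∷ D) w x (u ∷ us) (there x∈D) =
    trans (cong (λ z → z * w d + _) (𝟙-no (x ≟ d) (λ x≡d → lookup u x∈D (sym x≡d)))) (ΣL-pick D w x us x∈D)

-- Two lists without repetitions, one contained in the other and of equal length, are
-- permutations of each other.  (Used to see that multiplication by a unit permutes the
-- nonzero residues.)
module DistinctLists where

  open import Data.Nat using (pred)
  open import Data.List using (List; []; _∷_; _++_; length)
  open import Data.List.Relation.Unary.All as All using (All; []; _∷_)
  open import Data.List.Relation.Unary.AllPairs using (_∷_)
  open import Data.List.Relation.Unary.Unique.Propositional using (Unique)
  open import Data.List.Membership.Propositional using (_∈_)
  open import Data.List.Membership.Propositional.Properties using (∈-∃++)
  open import Data.List.Relation.Unary.Any using (here; there)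
  open import Data.List.Relation.Binary.Permutation.Propositional using (_↭_; prep; ↭-trans; ↭-refl)
  open import Data.List.Relation.Binary.Permutation.Propositional.Properties using (shift; ∈-resp-↭; ↭-length)
  open import Data.Product using (_×_; _,_)
  open import Data.Empty using (⊥-elim)
  open import Relation.Binary.PropositionalEquality

  module _ {A : Set} where

    All-delete : ∀ {P : A → Set} (as : List A) {x bs} → All P (as ++ x ∷ bs) → All P (as ++ bs)
    All-delete []       (_ ∷ ps) = ps
    All-delete (a ∷ as) (p ∷ ps) = p ∷ All-delete as ps

    Unique-delete : ∀ (as : List A) {x bs} → Unique (as ++ x ∷ bs) → Unique (as ++ bs)
    Unique-delete []       (_ ∷ u) = u
    Unique-delete (a ∷ as) (h ∷ u) = All-delete as h ∷ Unique-delete as u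

    distinct-⊆-↭ : ∀ (xs ys : List A) → Unique xs → Unique ys → All (_∈ ys) xs →
                   length xs ≡ length ys → ys ↭ xs
    distinct-⊆-↭ []       []  _         _  _           _   = ↭-refl
    distinct-⊆-↭ (x ∷ xs) ys  (x∉xs ∷ ux) uy (x∈ys ∷ xs⊆ys) len with ∈-∃++ x∈ys
    ... | as , bs , refl =
      ↭-trans (shift x as bs) (prep x (distinct-⊆-↭ xs (as ++ bs) ux (Unique-delete as uy) xs⊆rest len′))
      where
      avoid : ∀ {y} → x ≢ y × y ∈ (as ++ x ∷ bs) → y ∈ (as ++ bs)
      avoid (x≢y , y∈ys) with ∈-resp-↭ (shift x as bs) y∈ys
      ... | here y≡x   = ⊥-elim (x≢y (sym y≡x))
      ... | there y∈′  = y∈′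
      xs⊆rest : All (_∈ (as ++ bs)) xs
      xs⊆rest = All.zipWith avoid (x∉xs , xs⊆ys)
      len′ : length xs ≡ length (as ++ bs)
      len′ = cong pred (trans len (↭-length (shift x as bs)))

module Congruence (q : ℕ) where

  import Data.Nat.Properties as ℕP
  import Data.Nat.Divisibility as ℕD
  open import Data.Nat.DivMod using (_%_; _/_; m≡m%n+[m/n]*n)
  open import Data.Integer using (ℤ; +_; _+_; _-_; _*_; -_; _^_; ∣_∣)
  import Data.Integer.Properties as ℤP
  import Data.Integer.Divisibility.Signed as S
  open import Data.Integer.Tactic.RingSolver using (solve-∀)
  open import Relation.Nullary using (Dec)
  open import Relation.Nullary.Decidable using (map′)
  open import Relation.Binary.Bundles using (Setoid)
  open import Relation.Binary.Structures using (IsEquivalence)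
  open import Relation.Binary.PropositionalEquality
  import Relation.Binary.Reasoning.Setoid as SetoidReasoning

  -- x ≋ y means x ≡ y (mod q).  It is a record so that x and y are recoverable from a proof.
  infix 4 _≋_ _≋?_
  record _≋_ (x y : ℤ) : Set where
    constructor mk
    field get : (+ q) S.∣ (x - y)
  open _≋_ public

  ≋-reflexive : ∀ {x y} → x ≡ y → x ≋ y
  ≋-reflexive {x} refl = mk (subst ((+ q) S.∣_) (sym (ℤP.+-inverseʳ x)) (S.∣ᵤ⇒∣ (q ℕD.∣0)))

  ≋-refl : ∀ {x} → x ≋ x
  ≋-refl = ≋-reflexive refl

  ≋-sym : ∀ {x y} → x ≋ y → y ≋ x
  ≋-sym {x} {y} (mk d) = mk (subst ((+ q) S.∣_) (negate x y) (S.∣m⇒∣-m d))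
    where
    negate : ∀ x y → - (x - y) ≡ y - x
    negate = solve-∀

  ≋-trans : ∀ {x y z} → x ≋ y → y ≋ z → x ≋ z
  ≋-trans {x} {y} {z} (mk d) (mk e) = mk (subst ((+ q) S.∣_) (telescope x y z) (S.∣m∣n⇒∣m+n d e))
    where
    telescope : ∀ x y z → (x - y) + (y - z) ≡ x - z
    telescope = solve-∀

  _≋?_ : ∀ x y → Dec (x ≋ y)
  x ≋? y = map′ mk get ((+ q) S.∣? (x - y))

  ≋-isEquivalence : IsEquivalence _≋_
  ≋-isEquivalence = record { refl = ≋-refl ; sym = ≋-sym ; trans = ≋-trans }

  ≋-setoid : Setoid _ _
  ≋-setoid = record { isEquivalence = ≋-isEquivalence }

  module ≋-Reasoning = SetoidReasoning ≋-setoid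

  ≋-neg : ∀ {x y} → x ≋ y → - x ≋ - y
  ≋-neg {x} {y} (mk d) = mk (subst ((+ q) S.∣_) (negate x y) (S.∣m⇒∣-m d))
    where
    negate : ∀ x y → - (x - y) ≡ - x - - y
    negate = solve-∀

  ≋-+ : ∀ {a b c d} → a ≋ b → c ≋ d → a + c ≋ b + d
  ≋-+ {a} {b} {c} {d} (mk e) (mk f) = mk (subst ((+ q) S.∣_) (regroup a b c d) (S.∣m∣n⇒∣m+n e f))
    where
    regroup : ∀ a b c d → (a - b) + (c - d) ≡ (a + c) - (b + d)
    regroup = solve-∀

  ≋-* : ∀ {a b c d} → a ≋ b → c ≋ d → a * c ≋ b * d
  ≋-* {a} {b} {c} {d} (mk e) (mk f) =
    mk (subst ((+ q) S.∣_) (regroup a b c d) (S.∣m∣n⇒∣m+n (S.∣m⇒∣m*n c e) (S.∣n⇒∣m*n b f)))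
    where
    regroup : ∀ a b c d → (a - b) * c + b * (c - d) ≡ a * c - b * d
    regroup = solve-∀

  ≋-^ : ∀ {a b} k → a ≋ b → a ^ k ≋ b ^ k
  ≋-^ zero    _ = ≋-refl
  ≋-^ (suc k) e = ≋-* e (≋-^ k e)

  ≋0⇒∣ : ∀ {x} → x ≋ + 0 → q ℕD.∣ ∣ x ∣
  ≋0⇒∣ {x} (mk d) = S.∣⇒∣ᵤ (subst ((+ q) S.∣_) (ℤP.+-identityʳ x) d)

  ∣⇒≋0 : ∀ {x} → q ℕD.∣ ∣ x ∣ → x ≋ + 0
  ∣⇒≋0 {x} d = mk (subst ((+ q) S.∣_) (sym (ℤP.+-identityʳ x)) (S.∣ᵤ⇒∣ d))

  ≋⇒-≋0 : ∀ {x y} → x ≋ y → x - y ≋ + 0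
  ≋⇒-≋0 {x} {y} (mk d) = mk (subst ((+ q) S.∣_) (sym (ℤP.+-identityʳ (x - y))) d)

  -≋0⇒≋ : ∀ {x y} → x - y ≋ + 0 → x ≋ y
  -≋0⇒≋ {x} {y} (mk d) = mk (subst ((+ q) S.∣_) (ℤP.+-identityʳ (x - y)) d)

  pos-^ : ∀ a k → + (a ℕ.^ k) ≡ (+ a) ^ k
  pos-^ a zero    = refl
  pos-^ a (suc k) = trans (ℤP.pos-* a (a ℕ.^ k)) (cong (+ a *_) (pos-^ a k))

  pow≋1 : ∀ (y : ℤ) a b → y ^ a ≋ + 1 → y ^ (b ℕ.* a) ≋ + 1
  pow≋1 y a b e = begin
    y ^ (b ℕ.* a)   ≡⟨ cong (y ^_) (ℕP.*-comm b a) ⟩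
    y ^ (a ℕ.* b)   ≡⟨ ℤP.^-*-assoc y a b ⟨
    (y ^ a) ^ b     ≈⟨ ≋-^ b e ⟩
    (+ 1) ^ b       ≡⟨ ℤP.^-zeroˡ b ⟩
    + 1             ∎
    where open ≋-Reasoning

  %-≋ : ∀ x .{{_ : ℕ.NonZero q}} → + (x % q) ≋ + x
  %-≋ x = mk (subst ((+ q) S.∣_) quotient-part (S.∣m⇒∣-m (S.divides (+ (x / q)) (ℤP.pos-* (x / q) q))))
    where
    r = + (x % q)
    t = + (x / q ℕ.* q)
    cancel-r : ∀ r t → - t ≡ r - (r + t)
    cancel-r = solve-∀
    quotient-part : - t ≡ r - + x
    quotient-part = trans (cancel-r r t)
      (cong (λ z → r - z) (trans (sym (ℤP.pos-+ (x % q) (x / q ℕ.* q))) (cong +_ (sym (m≡m%n+[m/n]*n x q)))))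

module PrimeModulus (m : ℕ) (isPrime : Prime (suc (suc m))) where

  p n : ℕ
  p = suc (suc m)
  n = suc m

  open Congruence p public

  import Data.Nat.Properties as ℕP
  import Data.Nat.Divisibility as ℕD
  open import Data.Nat.DivMod using (_%_; m%n<n)
  open import Data.Integer using (+_; _-_; _*_; _^_; ∣_∣)
  import Data.Integer.Properties as ℤP
  open import Data.Integer.Tactic.RingSolver using (solve-∀)
  import Data.Nat.Tactic.RingSolver as ℕSolver
  open import Data.List using (List; []; _∷_; applyUpTo)
  open import Data.List.Properties using (length-applyUpTo)
  open import Data.List.Relation.Unary.All using (All; []; _∷_)
  import Data.List.Relation.Unary.All.Properties as AllP
  open import Data.List.Relation.Unary.Unique.Propositional using (Unique)
  import Data.List.Relation.Unary.Unique.Propositional.Properties as UniqueP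
  open import Data.List.Membership.Propositional using (_∈_)
  open import Data.List.Membership.Propositional.Properties using (∈-applyUpTo⁺)
  open import Data.Nat.ListAction using (product)
  open import Data.Nat.ListAction.Properties using (product-↭)
  open import Data.Sum using (_⊎_; inj₁; inj₂)
  open import Data.Product using (_×_; _,_)
  open import Data.List.Relation.Binary.Permutation.Propositional using (_↭_)
  open import Data.Empty using (⊥-elim)
  open import Relation.Nullary using (¬_)
  open import Relation.Binary.PropositionalEquality
  open import Function using (_∘_)
  open DistinctLists using (distinct-⊆-↭)

  zero-divisor : ∀ {x y} → x * y ≋ + 0 → x ≋ + 0 ⊎ y ≋ + 0
  zero-divisor {x} {y} xy≋0 with euclidsLemma ∣ x ∣ ∣ y ∣ isPrime (subst (p ℕD.∣_) (ℤP.abs-* x y) (≋0⇒∣ xy≋0))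
  ... | inj₁ p∣x = inj₁ (∣⇒≋0 p∣x)
  ... | inj₂ p∣y = inj₂ (∣⇒≋0 p∣y)

  cancelʳ : ∀ {x y z} → x * z ≋ y * z → ¬ (z ≋ + 0) → x ≋ y
  cancelʳ {x} {y} {z} xz≋yz z≉0 with zero-divisor {x - y} {z} (subst (_≋ + 0) (factor x y z) (≋⇒-≋0 xz≋yz))
    where
    factor : ∀ x y z → x * z - y * z ≡ (x - y) * z
    factor = solve-∀
  ... | inj₁ x-y≋0 = -≋0⇒≋ x-y≋0
  ... | inj₂ z≋0   = ⊥-elim (z≉0 z≋0)

  cancelˡ : ∀ {x y z} → z * x ≋ z * y → ¬ (z ≋ + 0) → x ≋ y
  cancelˡ {x} {y} {z} zx≋zy = cancelʳ (subst₂ _≋_ (ℤP.*-comm z x) (ℤP.*-comm z y) zx≋zy)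

  ∣-below-p : ∀ {d} → p ℕD.∣ d → d ℕ.< p → d ≡ 0
  ∣-below-p {zero}  _   _   = refl
  ∣-below-p {suc d} p∣d d<p = ⊥-elim (ℕD.>⇒∤ d<p p∣d)

  -- Congruent naturals b ≤ a < p are equal, since p divides a ∸ b < p.
  below-p-≤ : ∀ {a b} → b ℕ.≤ a → a ℕ.< p → + a ≋ + b → a ≡ b
  below-p-≤ {a} {b} b≤a a<p a≋b = ℕP.≤-antisym (ℕP.m∸n≡0⇒m≤n a∸b≡0) b≤a
    where
    distance : ∣ + a - + b ∣ ≡ a ℕ.∸ b
    distance = trans (cong ∣_∣ (ℤP.m-n≡m⊖n a b)) (trans (ℤP.∣m⊖n∣≡∣n⊖m∣ a b) (ℤP.∣⊖∣-≤ b≤a))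
    a∸b≡0 : a ℕ.∸ b ≡ 0
    a∸b≡0 = ∣-below-p (subst (p ℕD.∣_) distance (≋0⇒∣ (≋⇒-≋0 a≋b))) (ℕP.≤-<-trans (ℕP.m∸n≤m a b) a<p)

  below-p : ∀ {a b} → a ℕ.< p → b ℕ.< p → + a ≋ + b → a ≡ b
  below-p {a} {b} a<p b<p a≋b with ℕP.≤-total a b
  ... | inj₁ a≤b = sym (below-p-≤ a≤b b<p (≋-sym a≋b))
  ... | inj₂ b≤a = below-p-≤ b≤a a<p a≋b

  unit≉0 : ∀ {a} → 0 ℕ.< a → a ℕ.< p → ¬ (+ a ≋ + 0)
  unit≉0 {suc a} _ a<p a≋0 with below-p a<p (s≤s z≤n) a≋0
  ... | ()

  1≉0 : ¬ (+ 1 ≋ + 0)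
  1≉0 = unit≉0 (s≤s z≤n) (s≤s (s≤s z≤n))

  units : List ℕ
  units = applyUpTo suc n

  units-distinct : Unique units
  units-distinct = UniqueP.applyUpTo⁺₁ suc n (λ i<j _ → ℕP.<⇒≢ i<j ∘ ℕP.suc-injective)

  units-range : All (λ r → 0 ℕ.< r × r ℕ.< p) units
  units-range = AllP.applyUpTo⁺₁ suc n (λ i<n → s≤s z≤n , s≤s i<n)

  product≉0 : ∀ {xs} → All (λ x → ¬ (+ x ≋ + 0)) xs → ¬ (+ product xs ≋ + 0)
  product≉0 []                             = 1≉0
  product≉0 {x ∷ xs} (x≉0 ∷ xs≉0) prod≋0
    with zero-divisor (subst (_≋ + 0) (ℤP.pos-* x (product xs)) prod≋0)
  ... | inj₁ x≋0    = x≉0 x≋0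
  ... | inj₂ rest≋0 = product≉0 xs≉0 rest≋0

  product-% : ∀ (f : ℕ → ℕ) k → + product (applyUpTo (λ i → f i % p) k) ≋ + product (applyUpTo f k)
  product-% f zero    = ≋-refl
  product-% f (suc k) = begin
    + (f 0 % p ℕ.* product (applyUpTo (λ i → f (suc i) % p) k))   ≡⟨ ℤP.pos-* (f 0 % p) _ ⟩
    + (f 0 % p) * + product (applyUpTo (λ i → f (suc i) % p) k)   ≈⟨ ≋-* (%-≋ (f 0)) (product-% (f ∘ suc) k) ⟩
    + f 0 * + product (applyUpTo (f ∘ suc) k)                     ≡⟨ ℤP.pos-* (f 0) _ ⟨
    + product (applyUpTo f (suc k))                               ∎
    where open ≋-Reasoning

  product-scale : ∀ a (g : ℕ → ℕ) k → product (applyUpTo (λ i → a ℕ.* g i) k) ≡ a ℕ.^ k ℕ.* product (applyUpTo g k)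
  product-scale a g zero    = refl
  product-scale a g (suc k) =
    trans (cong (a ℕ.* g 0 ℕ.*_) (product-scale a (g ∘ suc) k)) (regroup a (g 0) (a ℕ.^ k) (product (applyUpTo (g ∘ suc) k)))
    where
    regroup : ∀ a x y z → a ℕ.* x ℕ.* (y ℕ.* z) ≡ a ℕ.* y ℕ.* (x ℕ.* z)
    regroup = ℕSolver.solve-∀

  -- Fermat's little theorem.  Multiplication by a unit a permutes the units,
  -- r ↦ a·r mod p; comparing products gives a^n · ∏ units ≡ ∏ units.
  module _ (a : ℕ) (a≉0 : ¬ (+ a ≋ + 0)) where

    private
      scaled : ℕ → ℕ
      scaled i = a ℕ.* suc i % p

      scaled≉0 : ∀ i → i ℕ.< n → ¬ (+ (a ℕ.* suc i) ≋ + 0)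
      scaled≉0 i i<n a*r≋0 with zero-divisor (subst (_≋ + 0) (ℤP.pos-* a (suc i)) a*r≋0)
      ... | inj₁ a≋0 = a≉0 a≋0
      ... | inj₂ r≋0 = unit≉0 (s≤s z≤n) (s≤s i<n) r≋0

      scaled-∈ : ∀ i → i ℕ.< n → scaled i ∈ units
      scaled-∈ i i<n with scaled i in eq | m%n<n (a ℕ.* suc i) p
      ... | zero  | _       = ⊥-elim (scaled≉0 i i<n (≋-trans (≋-sym (%-≋ (a ℕ.* suc i))) (≋-reflexive (cong +_ eq))))
      ... | suc k | s≤s k<n = ∈-applyUpTo⁺ suc k<n

      scaled-inj : ∀ {i j} → i ℕ.< n → j ℕ.< n → scaled i ≡ scaled j → i ≡ j
      scaled-inj {i} {j} i<n j<n eq = ℕP.suc-injective (below-p (s≤s i<n) (s≤s j<n) (cancelˡ ai≋aj a≉0))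
        where
        open ≋-Reasoning
        ai≋aj : + a * + suc i ≋ + a * + suc j
        ai≋aj = begin
          + a * + suc i     ≡⟨ ℤP.pos-* a (suc i) ⟨
          + (a ℕ.* suc i)   ≈⟨ %-≋ (a ℕ.* suc i) ⟨
          + scaled i        ≡⟨ cong +_ eq ⟩
          + scaled j        ≈⟨ %-≋ (a ℕ.* suc j) ⟩
          + (a ℕ.* suc j)   ≡⟨ ℤP.pos-* a (suc j) ⟩
          + a * + suc j     ∎

      units-↭ : units ↭ applyUpTo scaled n
      units-↭ = distinct-⊆-↭ (applyUpTo scaled n) units
        (UniqueP.applyUpTo⁺₁ scaled n (λ i<j j<n eq → ℕP.<⇒≢ i<j (scaled-inj (ℕP.<-trans i<j j<n) j<n eq)))
        units-distinct
        (AllP.applyUpTo⁺₁ scaled n (scaled-∈ _))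
        (trans (length-applyUpTo scaled n) (sym (length-applyUpTo suc n)))

    fermat : (+ a) ^ n ≋ + 1
    fermat = cancelʳ a^n*P≋P (product≉0 (AllP.applyUpTo⁺₁ suc n (λ i<n → unit≉0 (s≤s z≤n) (s≤s i<n))))
      where
      open ≋-Reasoning
      P = product units
      a^n*P≋P : (+ a) ^ n * + P ≋ + 1 * + P
      a^n*P≋P = begin
        (+ a) ^ n * + P                               ≡⟨ cong (_* + P) (pos-^ a n) ⟨
        + (a ℕ.^ n) * + P                             ≡⟨ ℤP.pos-* (a ℕ.^ n) P ⟨
        + (a ℕ.^ n ℕ.* P)                             ≡⟨ cong +_ (product-scale a suc n) ⟨
        + product (applyUpTo (λ i → a ℕ.* suc i) n)   ≈⟨ product-% (λ i → a ℕ.* suc i) n ⟨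
        + product (applyUpTo scaled n)                ≡⟨ cong +_ (product-↭ units-↭) ⟨
        + P                                           ≡⟨ ℤP.*-identityˡ (+ P) ⟨
        + 1 * + P                                     ∎

  unit^n : ∀ {r} → 0 ℕ.< r → r ℕ.< p → (+ r) ^ n ≋ + 1
  unit^n 0<r r<p = fermat _ (unit≉0 0<r r<p)

-- Integer polynomials as coefficient lists, lowest degree first: c₀ ∷ c₁ ∷ ⋯ stands for
-- c₀ + c₁·X + ⋯.  The degree of a nonzero polynomial is one less than the length of its list.
module Polynomials where

  import Data.Nat.Properties as ℕP
  open import Data.Integer using (ℤ; +_; _+_; _-_; _*_; -_; _^_)
  import Data.Integer.Properties as ℤP
  open import Data.Integer.Tactic.RingSolver using (solve-∀)
  open import Data.List using (List; []; _∷_; _++_; map; length; replicate)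
  open import Data.List.Properties using (length-++; length-replicate; length-map)
  open import Data.Product using (_×_; _,_; proj₁; proj₂)
  open import Relation.Binary.PropositionalEquality
  open ≡-Reasoning

  Poly : Set
  Poly = List ℤ

  ⟦_⟧ : Poly → ℤ → ℤ
  ⟦ []     ⟧ x = + 0
  ⟦ c ∷ cs ⟧ x = c + x * ⟦ cs ⟧ x

  lead : Poly → ℤ
  lead []           = + 0
  lead (c ∷ [])     = c
  lead (_ ∷ d ∷ cs) = lead (d ∷ cs)

  _⊕_ : Poly → Poly → Poly
  []      ⊕ g       = g
  (c ∷ f) ⊕ []      = c ∷ f
  (c ∷ f) ⊕ (d ∷ g) = (c + d) ∷ (f ⊕ g)

  _·_ : ℤ → Poly → Poly
  a · f = map (a *_) f

  eval-⊕ : ∀ f g x → ⟦ f ⊕ g ⟧ x ≡ ⟦ f ⟧ x + ⟦ g ⟧ x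
  eval-⊕ []      g       x = sym (ℤP.+-identityˡ _)
  eval-⊕ (c ∷ f) []      x = sym (ℤP.+-identityʳ _)
  eval-⊕ (c ∷ f) (d ∷ g) x = trans (cong (λ z → (c + d) + x * z) (eval-⊕ f g x)) (regroup c d x (⟦ f ⟧ x) (⟦ g ⟧ x))
    where
    regroup : ∀ c d x F G → (c + d) + x * (F + G) ≡ (c + x * F) + (d + x * G)
    regroup = solve-∀

  eval-· : ∀ a f x → ⟦ a · f ⟧ x ≡ a * ⟦ f ⟧ x
  eval-· a []      x = sym (ℤP.*-zeroʳ a)
  eval-· a (c ∷ f) x = trans (cong (λ z → a * c + x * z) (eval-· a f x)) (regroup a c x (⟦ f ⟧ x))
    where
    regroup : ∀ a c x F → a * c + x * (a * F) ≡ a * (c + x * F)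
    regroup = solve-∀

  ⊕-shorter : ∀ f g → length g ℕ.< length f → length (f ⊕ g) ≡ length f × lead (f ⊕ g) ≡ lead f
  ⊕-shorter (c ∷ f)          []            _        = refl , refl
  ⊕-shorter (c ∷ [])         (d ∷ g)       (s≤s ())
  ⊕-shorter (c ∷ c′ ∷ f)     (d ∷ [])      _        = refl , refl
  ⊕-shorter (c ∷ c′ ∷ f)     (d ∷ d′ ∷ g)  (s≤s lt) with ⊕-shorter (c′ ∷ f) (d′ ∷ g) lt
  ... | same-length , same-lead = cong suc same-length , same-lead

  -- Synthetic division by X - a: the quotient of c + X·f is f + a·(quotient of f).
  divide : ℤ → Poly → Poly
  divide a []      = []
  divide a (c ∷ f) = f ⊕ (a · divide a f)

  eval-divide : ∀ a f x → ⟦ f ⟧ x ≡ ⟦ f ⟧ a + (x - a) * ⟦ divide a f ⟧ x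
  eval-divide a []      x = sym (trans (ℤP.+-identityˡ _) (ℤP.*-zeroʳ (x - a)))
  eval-divide a (c ∷ f) x = begin
    c + x * ⟦ f ⟧ x                                      ≡⟨ cong (λ z → c + x * z) (eval-divide a f x) ⟩
    c + x * (Fa + (x - a) * Q)                           ≡⟨ regroup c x a Fa Q ⟩
    (c + a * Fa) + (x - a) * ((Fa + (x - a) * Q) + a * Q) ≡⟨ cong (λ z → (c + a * Fa) + (x - a) * (z + a * Q)) (eval-divide a f x) ⟨
    (c + a * Fa) + (x - a) * (⟦ f ⟧ x + a * Q)           ≡⟨ cong (λ z → (c + a * Fa) + (x - a) * z) quotient ⟨
    (c + a * Fa) + (x - a) * ⟦ divide a (c ∷ f) ⟧ x      ∎
    where
    Fa = ⟦ f ⟧ a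
    Q  = ⟦ divide a f ⟧ x
    regroup : ∀ c x a fa q → c + x * (fa + (x - a) * q) ≡ (c + a * fa) + (x - a) * ((fa + (x - a) * q) + a * q)
    regroup = solve-∀
    quotient : ⟦ divide a (c ∷ f) ⟧ x ≡ ⟦ f ⟧ x + a * Q
    quotient = trans (eval-⊕ f (a · divide a f) x) (cong (λ z → ⟦ f ⟧ x + z) (eval-· a (divide a f) x))

  factor : ∀ a f x → (x - a) * ⟦ divide a f ⟧ x ≡ ⟦ f ⟧ x - ⟦ f ⟧ a
  factor a f x = trans (solve-cancel (⟦ f ⟧ a) ((x - a) * ⟦ divide a f ⟧ x)) (cong (_- ⟦ f ⟧ a) (sym (eval-divide a f x)))
    where
    solve-cancel : ∀ fa d → d ≡ (fa + d) - fa
    solve-cancel = solve-∀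

  scaled-quotient-shorter : ∀ a d f → length (divide a (d ∷ f)) ≡ length f → length (a · divide a (d ∷ f)) ℕ.< length (d ∷ f)
  scaled-quotient-shorter a d f len = ℕP.≤-reflexive (cong suc (trans (length-map (a *_) (divide a (d ∷ f))) len))

  length-divide : ∀ a f → length (divide a f) ≡ ℕ.pred (length f)
  length-divide a []          = refl
  length-divide a (c ∷ [])    = refl
  length-divide a (c ∷ d ∷ f) =
    proj₁ (⊕-shorter (d ∷ f) (a · divide a (d ∷ f)) (scaled-quotient-shorter a d f (length-divide a (d ∷ f))))

  lead-divide : ∀ a c d f → lead (divide a (c ∷ d ∷ f)) ≡ lead (d ∷ f)
  lead-divide a c d f =
    proj₂ (⊕-shorter (d ∷ f) (a · divide a (d ∷ f)) (scaled-quotient-shorter a d f (length-divide a (d ∷ f))))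

  shift : ℕ → Poly → Poly
  shift k f = replicate k (+ 0) ++ f

  eval-shift : ∀ k f x → ⟦ shift k f ⟧ x ≡ x ^ k * ⟦ f ⟧ x
  eval-shift zero    f x = sym (ℤP.*-identityˡ _)
  eval-shift (suc k) f x = begin
    + 0 + x * ⟦ shift k f ⟧ x     ≡⟨ ℤP.+-identityˡ _ ⟩
    x * ⟦ shift k f ⟧ x           ≡⟨ cong (x *_) (eval-shift k f x) ⟩
    x * (x ^ k * ⟦ f ⟧ x)         ≡⟨ ℤP.*-assoc x (x ^ k) _ ⟨
    x ^ suc k * ⟦ f ⟧ x           ∎

  length-shift : ∀ k f → length (shift k f) ≡ k ℕ.+ length f
  length-shift k f = trans (length-++ (replicate k (+ 0))) (cong (ℕ._+ length f) (length-replicate k))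

  lead-∷-shift : ∀ c k d f → lead (c ∷ shift k (d ∷ f)) ≡ lead (d ∷ f)
  lead-∷-shift c zero    d f = refl
  lead-∷-shift c (suc k) d f = lead-∷-shift (+ 0) k d f

  powerMinusOne : ℕ → Poly
  powerMinusOne h = - + 1 ∷ shift h (+ 1 ∷ [])

  eval-powerMinusOne : ∀ h x → ⟦ powerMinusOne h ⟧ x ≡ x ^ suc h - + 1
  eval-powerMinusOne h x = begin
    - + 1 + x * ⟦ shift h (+ 1 ∷ []) ⟧ x    ≡⟨ cong (λ z → - + 1 + x * z) (eval-shift h (+ 1 ∷ []) x) ⟩
    - + 1 + x * (x ^ h * (+ 1 + x * + 0))   ≡⟨ simplify x (x ^ h) ⟩
    x * x ^ h - + 1                         ∎
    where
    simplify : ∀ x y → - + 1 + x * (y * (+ 1 + x * + 0)) ≡ x * y - + 1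
    simplify = solve-∀

  length-powerMinusOne : ∀ h → length (powerMinusOne h) ≡ suc (suc h)
  length-powerMinusOne h = cong suc (trans (length-shift h (+ 1 ∷ [])) (ℕP.+-comm h 1))

  lead-powerMinusOne : ∀ h → lead (powerMinusOne h) ≡ + 1
  lead-powerMinusOne h = lead-∷-shift (- + 1) h (+ 1) []

  geometric : ℕ → ℕ → Poly
  geometric h zero    = + 1 ∷ []
  geometric h (suc k) = + 1 ∷ shift h (geometric h k)

  geometric-identity : ∀ h k x → (x ^ suc h - + 1) * ⟦ geometric h k ⟧ x ≡ (x ^ suc h) ^ suc k - + 1
  geometric-identity h zero    x = simplify (x ^ suc h) x
    where
    simplify : ∀ y x → (y - + 1) * (+ 1 + x * + 0) ≡ y * + 1 - + 1
    simplify = solve-∀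
  geometric-identity h (suc k) x = begin
    (y - + 1) * (+ 1 + x * ⟦ shift h (geometric h k) ⟧ x)   ≡⟨ cong (λ z → (y - + 1) * (+ 1 + x * z)) (eval-shift h (geometric h k) x) ⟩
    (y - + 1) * (+ 1 + x * (x ^ h * G))                    ≡⟨ expand x (x ^ h) G ⟩
    (y - + 1) + y * ((y - + 1) * G)                        ≡⟨ cong (λ z → (y - + 1) + y * z) (geometric-identity h k x) ⟩
    (y - + 1) + y * (y ^ suc k - + 1)                      ≡⟨ telescope y (y ^ suc k) ⟩
    y * y ^ suc k - + 1                                    ∎
    where
    y = x ^ suc h
    G = ⟦ geometric h k ⟧ x
    expand : ∀ x xʰ G → (x * xʰ - + 1) * (+ 1 + x * (xʰ * G)) ≡ (x * xʰ - + 1) + x * xʰ * ((x * xʰ - + 1) * G)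
    expand = solve-∀
    telescope : ∀ y Y → (y - + 1) + y * (Y - + 1) ≡ y * Y - + 1
    telescope = solve-∀

  length-geometric : ∀ h k → length (geometric h k) ≡ suc (k ℕ.* suc h)
  length-geometric h zero    = refl
  length-geometric h (suc k) =
    cong suc (trans (length-shift h (geometric h k)) (trans (cong (h ℕ.+_) (length-geometric h k)) (ℕP.+-suc h _)))

  lead-geometric : ∀ h k → lead (geometric h k) ≡ + 1
  lead-geometric h zero          = refl
  lead-geometric h (suc zero)    = lead-∷-shift (+ 1) h (+ 1) []
  lead-geometric h (suc (suc k)) = trans (lead-∷-shift (+ 1) h (+ 1) (shift h (geometric h k))) (lead-geometric h (suc k))

module RootCounting (m : ℕ) (isPrime : Prime (suc (suc m))) where

  open PrimeModulus m isPrime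
  open Polynomials
  open FiniteSums using (Σ<; 𝟙; 𝟙-⇔; Σ-ext; count; count-⊎)
  import Data.Nat.Properties as ℕP
  open import Data.Nat.GCD using (gcd; gcd-GCD; gcd[m,n]∣m; gcd[m,n]∣n; module Bézout)
  import Data.Nat.Divisibility as ℕD
  open import Data.Integer using (ℤ; +_; _+_; _-_; _*_; _^_)
  import Data.Integer.Properties as ℤP
  open import Data.List using (List; []; _∷_; length; filter)
  open import Data.List.Properties using (length-applyUpTo)
  open import Data.List.Relation.Unary.All as All using (All; []; _∷_)
  import Data.List.Relation.Unary.All.Properties as AllP
  open import Data.List.Relation.Unary.AllPairs using (_∷_)
  open import Data.List.Relation.Unary.Unique.Propositional using (Unique)
  import Data.List.Relation.Unary.Unique.Propositional.Properties as UniqueP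
  open import Data.Product using (_×_; _,_; proj₁; proj₂)
  open import Data.Sum using (_⊎_; inj₁; inj₂)
  open import Data.Empty using (⊥-elim)
  open import Relation.Nullary using (¬_)
  open import Relation.Unary using (Decidable)
  open import Relation.Binary.PropositionalEquality

  quotient-root : ∀ {a b} f → a ℕ.< p → b ℕ.< p → a ≢ b →
                  ⟦ f ⟧ (+ a) ≋ + 0 → ⟦ f ⟧ (+ b) ≋ + 0 → ⟦ divide (+ a) f ⟧ (+ b) ≋ + 0
  quotient-root {a} {b} f a<p b<p a≢b fa≋0 fb≋0 with zero-divisor product≋0
    where
    open ≋-Reasoning
    product≋0 : (+ b - + a) * ⟦ divide (+ a) f ⟧ (+ b) ≋ + 0
    product≋0 = begin
      (+ b - + a) * ⟦ divide (+ a) f ⟧ (+ b)   ≡⟨ factor (+ a) f (+ b) ⟩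
      ⟦ f ⟧ (+ b) - ⟦ f ⟧ (+ a)                ≈⟨ ≋-+ fb≋0 (≋-neg fa≋0) ⟩
      + 0                                      ∎
  ... | inj₁ b-a≋0 = ⊥-elim (a≢b (sym (below-p b<p a<p (-≋0⇒≋ b-a≋0))))
  ... | inj₂ q≋0   = q≋0

  root-bound : ∀ (rs : List ℕ) f → Unique rs → All (ℕ._< p) rs → All (λ r → ⟦ f ⟧ (+ r) ≋ + 0) rs →
               ¬ (lead f ≋ + 0) → length rs ℕ.< length f
  root-bound rs       []          _ _ _ lead≉0 = ⊥-elim (lead≉0 ≋-refl)
  root-bound []       (c ∷ f)     _ _ _ _      = s≤s z≤n
  root-bound (a ∷ rs) (c ∷ [])    _ _ (c≋0 ∷ _) lead≉0 =
    ⊥-elim (lead≉0 (≋-trans (≋-reflexive (sym (trans (cong (λ z → c + z) (ℤP.*-zeroʳ (+ a))) (ℤP.+-identityʳ c)))) c≋0))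
  root-bound (a ∷ rs) (c ∷ d ∷ f) (a∉rs ∷ distinct) (a<p ∷ below) (a-root ∷ roots) lead≉0 =
    s≤s (subst (length rs ℕ.<_) (length-divide (+ a) (c ∷ d ∷ f))
      (root-bound rs (divide (+ a) (c ∷ d ∷ f)) distinct below (quotient-roots a∉rs below roots)
        (λ q≋0 → lead≉0 (subst (_≋ + 0) (lead-divide (+ a) c d f) q≋0))))
    where
    quotient-roots : ∀ {bs} → All (a ≢_) bs → All (ℕ._< p) bs → All (λ r → ⟦ c ∷ d ∷ f ⟧ (+ r) ≋ + 0) bs →
                     All (λ r → ⟦ divide (+ a) (c ∷ d ∷ f) ⟧ (+ r) ≋ + 0) bs
    quotient-roots [] [] [] = []
    quotient-roots (a≢b ∷ a≢bs) (b<p ∷ bs<p) (b-root ∷ bs-roots) =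
      quotient-root (c ∷ d ∷ f) a<p b<p a≢b a-root b-root ∷ quotient-roots a≢bs bs<p bs-roots

  count-roots : ∀ {P : ℕ → Set} (P? : Decidable P) f → (∀ {r} → P r → ⟦ f ⟧ (+ r) ≋ + 0) →
                ¬ (lead f ≋ + 0) → length (filter P? units) ℕ.< length f
  count-roots P? f root lead≉0 =
    root-bound (filter P? units) f (UniqueP.filter⁺ P? units-distinct)
      (AllP.filter⁺ P? (All.map proj₂ units-range)) (All.map root (AllP.all-filter P? units)) lead≉0

  Root : ℕ → ℕ → Set
  Root k r = (+ r) ^ k ≋ + 1

  Root? : ∀ k → Decidable (Root k)
  Root? k r = (+ r) ^ k ≋? + 1

  R : ℕ → ℕ
  R k = length (filter (Root? k) units)

  pow-cancel : ∀ (y : ℤ) d c → y ^ (d ℕ.+ c) ≋ + 1 → y ^ c ≋ + 1 → y ^ d ≋ + 1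
  pow-cancel y d c y^d+c≋1 y^c≋1 = cancelʳ y^d*y^c≋y^c (λ y^c≋0 → 1≉0 (≋-trans (≋-sym y^c≋1) y^c≋0))
    where
    open ≋-Reasoning
    y^d*y^c≋y^c : y ^ d * y ^ c ≋ + 1 * y ^ c
    y^d*y^c≋y^c = begin
      y ^ d * y ^ c    ≡⟨ ℤP.^-distribˡ-+-* y d c ⟨
      y ^ (d ℕ.+ c)    ≈⟨ y^d+c≋1 ⟩
      + 1              ≈⟨ y^c≋1 ⟨
      y ^ c            ≡⟨ ℤP.*-identityˡ (y ^ c) ⟨
      + 1 * y ^ c      ∎

  pow-gcd : ∀ (y : ℤ) a b → y ^ a ≋ + 1 → y ^ b ≋ + 1 → y ^ gcd a b ≋ + 1
  pow-gcd y a b y^a≋1 y^b≋1 with Bézout.identity (gcd-GCD a b)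
  ... | Bézout.+- x z eq =
    pow-cancel y (gcd a b) (z ℕ.* b) (subst (λ e → y ^ e ≋ + 1) (sym eq) (pow≋1 y a x y^a≋1)) (pow≋1 y b z y^b≋1)
  ... | Bézout.-+ x z eq =
    pow-cancel y (gcd a b) (x ℕ.* a) (subst (λ e → y ^ e ≋ + 1) (sym eq) (pow≋1 y b z y^b≋1)) (pow≋1 y a x y^a≋1)

  -- For a unit r, whether r^k ≡ 1 depends only on gcd(k, n), because r^n ≡ 1.
  Root-gcd : ∀ k {r} → 0 ℕ.< r → r ℕ.< p → (Root k r → Root (gcd k n) r) × (Root (gcd k n) r → Root k r)
  Root-gcd k {r} 0<r r<p = (λ rk → pow-gcd (+ r) k n rk (unit^n 0<r r<p)) , from-gcd
    where
    from-gcd : Root (gcd k n) r → Root k r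
    from-gcd rg with gcd[m,n]∣m k n
    ... | ℕD.divides q k≡qg = subst (λ e → Root e r) (sym k≡qg) (pow≋1 (+ r) (gcd k n) q rg)

  R-gcd-invariant : ∀ k → R k ≡ R (gcd k n)
  R-gcd-invariant k = begin
    R k                                                  ≡⟨ count (Root? k) suc n ⟩
    Σ< (λ i → 𝟙 (Root? k (suc i))) n                     ≡⟨ Σ-ext n (λ i i<n → equivalent i (s≤s i<n)) ⟩
    Σ< (λ i → 𝟙 (Root? (gcd k n) (suc i))) n             ≡⟨ count (Root? (gcd k n)) suc n ⟨
    R (gcd k n)                                          ∎
    where
    open ≡-Reasoning
    equivalent : ∀ i → suc i ℕ.< p → 𝟙 (Root? k (suc i)) ≡ 𝟙 (Root? (gcd k n) (suc i))
    equivalent i r<p = 𝟙-⇔ (Root? k (suc i)) (Root? (gcd k n) (suc i))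
      (proj₁ (Root-gcd k (s≤s z≤n) r<p)) (proj₂ (Root-gcd k (s≤s z≤n) r<p))

  -- At most g of the units are g-th roots of unity: they are roots of X^g - 1.
  R-upper : ∀ h → R (suc h) ℕ.≤ suc h
  R-upper h = ℕP.≤-pred (subst (R (suc h) ℕ.<_) (length-powerMinusOne h)
    (count-roots (Root? (suc h)) (powerMinusOne h) root-of-X^g-1 (subst (λ c → ¬ (c ≋ + 0)) (sym (lead-powerMinusOne h)) 1≉0)))
    where
    root-of-X^g-1 : ∀ {r} → Root (suc h) r → ⟦ powerMinusOne h ⟧ (+ r) ≋ + 0
    root-of-X^g-1 {r} r^g≋1 = begin
      ⟦ powerMinusOne h ⟧ (+ r)   ≡⟨ eval-powerMinusOne h (+ r) ⟩
      (+ r) ^ suc h - + 1         ≈⟨ ≋⇒-≋0 r^g≋1 ⟩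
      + 0                         ∎
      where open ≋-Reasoning

  -- If g ∣ n, at least g of the units are g-th roots of unity: every unit is a root of
  -- X^n - 1 = (X^g - 1)·(1 + X^g + ⋯ + X^(n-g)), and the second factor has at most n - g roots.
  R-lower : ∀ h q → n ≡ suc q ℕ.* suc h → suc h ℕ.≤ R (suc h)
  R-lower h q n≡qg = ℕP.+-cancelʳ-≤ (q ℕ.* suc h) (suc h) (R (suc h)) covering
    where
    Geo : ℕ → Set
    Geo r = ⟦ geometric h q ⟧ (+ r) ≋ + 0
    Geo? : Decidable Geo
    Geo? r = ⟦ geometric h q ⟧ (+ r) ≋? + 0
    geometric-roots : length (filter Geo? units) ℕ.≤ q ℕ.* suc h
    geometric-roots = ℕP.≤-pred (subst (length (filter Geo? units) ℕ.<_) (length-geometric h q)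
      (count-roots Geo? (geometric h q) (λ r → r) (subst (λ c → ¬ (c ≋ + 0)) (sym (lead-geometric h q)) 1≉0)))
    split : ∀ {r} → 0 ℕ.< r × r ℕ.< p → Root (suc h) r ⊎ Geo r
    split {r} (0<r , r<p) with zero-divisor product≋0
      where
      open ≋-Reasoning
      y = (+ r) ^ suc h
      product≋0 : (y - + 1) * ⟦ geometric h q ⟧ (+ r) ≋ + 0
      product≋0 = begin
        (y - + 1) * ⟦ geometric h q ⟧ (+ r)   ≡⟨ geometric-identity h q (+ r) ⟩
        y ^ suc q - + 1                       ≡⟨ cong (_- + 1) (ℤP.^-*-assoc (+ r) (suc h) (suc q)) ⟩
        (+ r) ^ (suc h ℕ.* suc q) - + 1       ≡⟨ cong (λ e → (+ r) ^ e - + 1) (trans (ℕP.*-comm (suc h) (suc q)) (sym n≡qg)) ⟩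
        (+ r) ^ n - + 1                       ≈⟨ ≋⇒-≋0 (unit^n 0<r r<p) ⟩
        + 0                                   ∎
    ... | inj₁ y-1≋0 = inj₁ (-≋0⇒≋ y-1≋0)
    ... | inj₂ geo≋0 = inj₂ geo≋0
    covering : suc h ℕ.+ q ℕ.* suc h ℕ.≤ R (suc h) ℕ.+ q ℕ.* suc h
    covering = begin
      suc h ℕ.+ q ℕ.* suc h                        ≡⟨ n≡qg ⟨
      n                                            ≡⟨ length-applyUpTo suc n ⟨
      length units                                 ≤⟨ count-⊎ (Root? (suc h)) Geo? units (All.map split units-range) ⟩
      R (suc h) ℕ.+ length (filter Geo? units)     ≤⟨ ℕP.+-monoʳ-≤ (R (suc h)) geometric-roots ⟩
      R (suc h) ℕ.+ q ℕ.* suc h                    ∎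
      where open ℕP.≤-Reasoning

  R≡gcd : ∀ k → R k ≡ gcd k n
  R≡gcd k = trans (R-gcd-invariant k) (exact (gcd k n) (gcd[m,n]∣n k n))
    where
    exact : ∀ g → g ℕD.∣ n → R g ≡ g
    exact zero    (ℕD.divides q n≡q*0)       = ⊥-elim (ℕP.0≢1+n (trans (sym (ℕP.*-zeroʳ q)) (sym n≡q*0)))
    exact (suc h) (ℕD.divides zero n≡0)      = ⊥-elim (ℕP.0≢1+n (sym n≡0))
    exact (suc h) (ℕD.divides (suc q) n≡qg)  = ℕP.≤-antisym (R-upper h) (R-lower h q n≡qg)

module Reduction (m : ℕ) (isPrime : Prime (suc (suc m))) where

  open import Defs using (G; GProp; GProp?)
  open PrimeModulus m isPrime
  open RootCounting m isPrime
  open FiniteSums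
  import Data.Nat.Properties as ℕP
  open import Data.Nat.GCD using (gcd)
  import Data.Nat.Divisibility as ℕD
  import Data.Nat.Tactic.RingSolver as ℕSolver
  open import Data.Integer using (+_; _-_; _*_; _^_)
  import Data.Integer.Properties as ℤP
  import Data.Integer.Divisibility.Signed as S
  open import Data.Product using (_×_; _,_; proj₁; proj₂)
  open import Relation.Binary.PropositionalEquality

  module _ (j t : ℕ) where

    x r : ℕ
    x = suc (j ℕ.* p ℕ.+ t)
    r = suc t

    x≋r : + x ≋ + r
    x≋r = mk (subst ((+ p) S.∣_) difference (S.∣ᵤ⇒∣ (ℕD.n∣m*n j)))
      where
      difference : + (j ℕ.* p) ≡ + x - + r
      difference = sym (trans (ℤP.m-n≡m⊖n x r)
        (trans (ℤP.⊖-≥ (s≤s (ℕP.m≤n+m t (j ℕ.* p)))) (cong +_ (ℕP.m+n∸n≡m (j ℕ.* p) t))))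

    -- For a unit r, Fermat reduces x^x = r^(1 + j·n + (j + t)) to r · r^(j + t).
    x^x≋r·r^[j+t] : t ℕ.< n → + (x ℕ.^ x) ≋ + r * (+ r) ^ (j ℕ.+ t)
    x^x≋r·r^[j+t] t<n = begin
      + (x ℕ.^ x)                                     ≡⟨ pos-^ x x ⟩
      (+ x) ^ x                                       ≈⟨ ≋-^ x x≋r ⟩
      + r * (+ r) ^ (j ℕ.* p ℕ.+ t)                   ≡⟨ cong (λ e → + r * (+ r) ^ e) (exponent j t m) ⟩
      + r * (+ r) ^ (j ℕ.* n ℕ.+ (j ℕ.+ t))           ≡⟨ cong (+ r *_) (ℤP.^-distribˡ-+-* (+ r) (j ℕ.* n) (j ℕ.+ t)) ⟩
      + r * ((+ r) ^ (j ℕ.* n) * (+ r) ^ (j ℕ.+ t))   ≈⟨ ≋-* (≋-refl {+ r}) (≋-* (pow≋1 (+ r) n j (unit^n (s≤s z≤n) (s≤s t<n))) ≋-refl) ⟩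
      + r * (+ 1 * (+ r) ^ (j ℕ.+ t))                 ≡⟨ cong (+ r *_) (ℤP.*-identityˡ _) ⟩
      + r * (+ r) ^ (j ℕ.+ t)                         ∎
      where
      open ≋-Reasoning
      exponent : ∀ j t m → j ℕ.* suc (suc m) ℕ.+ t ≡ j ℕ.* suc m ℕ.+ (j ℕ.+ t)
      exponent = ℕSolver.solve-∀

    GProp⇔Root : t ℕ.< n → (GProp p x → Root (j ℕ.+ t) r) × (Root (j ℕ.+ t) r → GProp p x)
    GProp⇔Root t<n = to , from
      where
      open ≋-Reasoning
      r≉0 = unit≉0 (s≤s z≤n) (s≤s t<n)
      to : GProp p x → Root (j ℕ.+ t) r
      to (_ , x^x≡x) = cancelˡ (begin
        + r * (+ r) ^ (j ℕ.+ t)   ≈⟨ x^x≋r·r^[j+t] t<n ⟨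
        + (x ℕ.^ x)               ≈⟨ mk x^x≡x ⟩
        + x                       ≈⟨ x≋r ⟩
        + r                       ≡⟨ ℤP.*-identityʳ (+ r) ⟨
        + r * + 1                 ∎) r≉0
      from : Root (j ℕ.+ t) r → GProp p x
      from root = (λ p∣x → r≉0 (≋-trans (≋-sym x≋r) (∣⇒≋0 p∣x))) , get (begin
        + (x ℕ.^ x)               ≈⟨ x^x≋r·r^[j+t] t<n ⟩
        + r * (+ r) ^ (j ℕ.+ t)   ≈⟨ ≋-* (≋-refl {+ r}) root ⟩
        + r * + 1                 ≡⟨ ℤP.*-identityʳ (+ r) ⟩
        + r                       ≈⟨ x≋r ⟨
        + x                       ∎)

  -- The last element j·p + p of each block is a multiple of p.
  multiple-excluded : ∀ j → 𝟙 (GProp? p (suc (j ℕ.* p ℕ.+ n))) ≡ 0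
  multiple-excluded j = 𝟙-no (GProp? p _) (λ gp → proj₁ gp (ℕD.divides (suc j) (multiple j m)))
    where
    multiple : ∀ j m → suc (j ℕ.* suc (suc m) ℕ.+ suc m) ≡ suc j ℕ.* suc (suc m)
    multiple = ℕSolver.solve-∀

  block : ∀ j → Σ< (λ t → 𝟙 (GProp? p (suc (j ℕ.* p ℕ.+ t)))) p ≡ Σ< (λ t → 𝟙 (Root? (j ℕ.+ t) (suc t))) n
  block j = trans (cong (Σ< term n ℕ.+_) (multiple-excluded j)) (trans (ℕP.+-identityʳ _) (Σ-ext n same))
    where
    term : ℕ → ℕ
    term t = 𝟙 (GProp? p (suc (j ℕ.* p ℕ.+ t)))
    same : ∀ t → t ℕ.< n → 𝟙 (GProp? p (suc (j ℕ.* p ℕ.+ t))) ≡ 𝟙 (Root? (j ℕ.+ t) (suc t))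
    same t t<n = 𝟙-⇔ (GProp? p _) (Root? (j ℕ.+ t) (suc t)) (proj₁ (GProp⇔Root j t t<n)) (proj₂ (GProp⇔Root j t t<n))

  Root-periodic : ∀ t → t ℕ.< n → ∀ k → 𝟙 (Root? (k ℕ.+ n) (suc t)) ≡ 𝟙 (Root? k (suc t))
  Root-periodic t t<n k = 𝟙-⇔ (Root? (k ℕ.+ n) (suc t)) (Root? k (suc t))
    (λ root → ≋-trans r^k≋r^[k+n] root) (λ root → ≋-trans (≋-sym r^k≋r^[k+n]) root)
    where
    open ≋-Reasoning
    r^k≋r^[k+n] : (+ suc t) ^ k ≋ (+ suc t) ^ (k ℕ.+ n)
    r^k≋r^[k+n] = begin
      (+ suc t) ^ k                          ≡⟨ ℤP.*-identityʳ _ ⟨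
      (+ suc t) ^ k * + 1                    ≈⟨ ≋-* (≋-refl {(+ suc t) ^ k}) (unit^n (s≤s z≤n) (s≤s t<n)) ⟨
      (+ suc t) ^ k * (+ suc t) ^ n          ≡⟨ ℤP.^-distribˡ-+-* (+ suc t) k n ⟨
      (+ suc t) ^ (k ℕ.+ n)                  ∎

  G≡Σgcd : G p ≡ Σ< (λ k → gcd k n) n
  G≡Σgcd = begin
    G p                                                            ≡⟨ count (GProp? p) suc (n ℕ.* p) ⟩
    Σ< (λ i → 𝟙 (GProp? p (suc i))) (n ℕ.* p)                      ≡⟨ Σ-block (λ i → 𝟙 (GProp? p (suc i))) n p ⟩
    Σ< (λ j → Σ< (λ t → 𝟙 (GProp? p (suc (j ℕ.* p ℕ.+ t)))) p) n   ≡⟨ Σ-ext n (λ j _ → block j) ⟩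
    Σ< (λ j → Σ< (λ t → 𝟙 (Root? (j ℕ.+ t) (suc t))) n) n          ≡⟨ Σ-swap (λ j t → 𝟙 (Root? (j ℕ.+ t) (suc t))) n n ⟩
    Σ< (λ t → Σ< (λ j → 𝟙 (Root? (j ℕ.+ t) (suc t))) n) n          ≡⟨ Σ-ext n periodic ⟩
    Σ< (λ t → Σ< (λ k → 𝟙 (Root? k (suc t))) n) n                  ≡⟨ Σ-swap (λ t k → 𝟙 (Root? k (suc t))) n n ⟩
    Σ< (λ k → Σ< (λ t → 𝟙 (Root? k (suc t))) n) n                  ≡⟨ Σ-ext n (λ k _ → sym (count (Root? k) suc n)) ⟩
    Σ< R n                                                         ≡⟨ Σ-ext n (λ k _ → R≡gcd k) ⟩
    Σ< (λ k → gcd k n) n                                           ∎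
    where
    open ≡-Reasoning
    periodic : ∀ t → t ℕ.< n → Σ< (λ j → 𝟙 (Root? (j ℕ.+ t) (suc t))) n ≡ Σ< (λ k → 𝟙 (Root? k (suc t))) n
    periodic t t<n = Σ-periodic (λ k → 𝟙 (Root? k (suc t))) n (Root-periodic t t<n) t

-- Pillai's identity Σ_{1≤k≤N} gcd(k, N) = Σ_{d∣N} (N/d)·φ(d).  Each k contributes
-- gcd(k, N) = N/d for d = N/gcd(k, N), and exactly φ(d) values of k give a particular d.
module Pillai where

  open import Data.Nat
  open import Data.Nat.Properties
  open import Data.Nat.DivMod using (_/_; m*n/n≡m)
  open import Data.Nat.Divisibility using (_∣_; _∣?_; divides; ∣m+n∣m⇒∣n; n∣m*n; ∣⇒≤)
  open import Data.Nat.GCD using (gcd; gcd-GCD; gcd[m,n]∣m; gcd[m,n]∣n; gcd[m,n]≢0; c*gcd[m,n]≡gcd[cm,cn]; gcd-identityˡ; module GCD)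
  open import Data.Nat.Coprimality using (coprime?; coprime⇒gcd≡1; gcd≡1⇒coprime)
  open import Data.List using (List; filter)
  open import Data.List.Relation.Unary.All as All using (All)
  import Data.List.Relation.Unary.All.Properties as AllP
  open import Data.List.Relation.Unary.Unique.Propositional using (Unique)
  import Data.List.Relation.Unary.Unique.Propositional.Properties as UniqueP
  open import Data.List.Membership.Propositional using (_∈_)
  open import Data.List.Membership.Propositional.Properties using (∈-filter⁺; ∈-applyUpTo⁺)
  open import Data.Product using (_×_; _,_; proj₁; proj₂)
  open import Data.Sum using (inj₁)
  open import Data.Empty using (⊥-elim)
  open import Relation.Binary.PropositionalEquality
  open import Function using (_∘′_)
  open import Defs using (oneTo; φ)
  open FiniteSums

  cofactor : ℕ → ℕ → ℕ
  cofactor N zero    = 0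
  cofactor N (suc d) = N / suc d

  cofactor-of : ∀ {N} q d → N ≡ q * suc d → cofactor N (suc d) ≡ q
  cofactor-of {N} q d N≡qd = trans (cong (_/ suc d) N≡qd) (m*n/n≡m q (suc d))

  divisors : ℕ → List ℕ
  divisors N = filter (λ d → d ∣? N) (oneTo N)

  divisors-distinct : ∀ N → Unique (divisors N)
  divisors-distinct N = UniqueP.filter⁺ (λ d → d ∣? N) (UniqueP.applyUpTo⁺₁ suc N (λ i<j _ → <⇒≢ i<j ∘′ suc-injective))

  divisors-positive : ∀ N → All (λ d → d ∣ N × 0 < d) (divisors N)
  divisors-positive N = All.zipWith (λ x → x)
    (AllP.all-filter (λ d → d ∣? N) (oneTo N) , AllP.filter⁺ (λ d → d ∣? N) (AllP.applyUpTo⁺₁ suc N (λ _ → s≤s z≤n)))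

  φ-as-sum : ∀ d → φ d ≡ Σ< (λ i → 𝟙 (gcd (suc i) d ≟ 1)) d
  φ-as-sum d = trans (count (λ k → coprime? k d) suc d)
    (Σ-ext d (λ i _ → 𝟙-⇔ (coprime? (suc i) d) (gcd (suc i) d ≟ 1) coprime⇒gcd≡1 gcd≡1⇒coprime))

  -- Among 1, …, d·e exactly φ(d) numbers k have gcd(k, d·e) = e: in the i-th block of e
  -- consecutive numbers only the last one, (i+1)·e, is a multiple of e, and
  -- gcd((i+1)·e, d·e) = gcd(i+1, d)·e.
  gcd-count : ∀ d e′ → Σ< (λ k → 𝟙 (gcd (suc k) (d * suc e′) ≟ suc e′)) (d * suc e′) ≡ φ d
  gcd-count d e′ = begin
    Σ< (λ k → 𝟙 (gcd (suc k) N ≟ e)) (d * e)                      ≡⟨ Σ-block (λ k → 𝟙 (gcd (suc k) N ≟ e)) d e ⟩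
    Σ< (λ i → Σ< (λ t → 𝟙 (gcd (suc (i * e + t)) N ≟ e)) e) d    ≡⟨ Σ-ext d (λ i _ → block i) ⟩
    Σ< (λ i → 𝟙 (gcd (suc i) d ≟ 1)) d                            ≡⟨ φ-as-sum d ⟨
    φ d                                                           ∎
    where
    open ≡-Reasoning
    e = suc e′
    N = d * e
    not-multiple : ∀ i t → t < e′ → 𝟙 (gcd (suc (i * e + t)) N ≟ e) ≡ 0
    not-multiple i t t<e′ = 𝟙-no (gcd (suc (i * e + t)) N ≟ e) λ g≡e →
      let e∣i*e+1+t : e ∣ i * e + suc t
          e∣i*e+1+t = subst (e ∣_) (sym (+-suc (i * e) t)) (subst (_∣ suc (i * e + t)) g≡e (gcd[m,n]∣m _ N))
      in <-irrefl refl (<-≤-trans (s≤s t<e′) (∣⇒≤ (∣m+n∣m⇒∣n e∣i*e+1+t (n∣m*n i))))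
    gcd-multiple : ∀ i → gcd (suc (i * e + e′)) N ≡ gcd (suc i) d * e
    gcd-multiple i = begin
      gcd (suc (i * e + e′)) N   ≡⟨ cong₂ gcd (trans (sym (+-suc (i * e) e′)) (trans (+-comm (i * e) e) (*-comm (suc i) e))) (*-comm d e) ⟩
      gcd (e * suc i) (e * d)    ≡⟨ c*gcd[m,n]≡gcd[cm,cn] e (suc i) d ⟨
      e * gcd (suc i) d          ≡⟨ *-comm e (gcd (suc i) d) ⟩
      gcd (suc i) d * e          ∎
    multiple : ∀ i → 𝟙 (gcd (suc (i * e + e′)) N ≟ e) ≡ 𝟙 (gcd (suc i) d ≟ 1)
    multiple i = 𝟙-⇔ (gcd (suc (i * e + e′)) N ≟ e) (gcd (suc i) d ≟ 1)
      (λ g≡e → *-cancelʳ-≡ (gcd (suc i) d) 1 e (trans (sym (gcd-multiple i)) (trans g≡e (sym (+-identityʳ e)))))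
      (λ g≡1 → trans (gcd-multiple i) (trans (cong (_* e) g≡1) (+-identityʳ e)))
    block : ∀ i → Σ< (λ t → 𝟙 (gcd (suc (i * e + t)) N ≟ e)) e ≡ 𝟙 (gcd (suc i) d ≟ 1)
    block i = cong₂ _+_ (trans (Σ-ext e′ (λ t t<e′ → not-multiple i t t<e′)) (Σ-zero e′)) (multiple i)

  module _ (N : ℕ) (0<N : 0 < N) where

    private
      g≢0 : ∀ k → gcd (suc k) N ≢ 0
      g≢0 k = gcd[m,n]≢0 (suc k) N (inj₁ λ ())

    class : ℕ → ℕ
    class k = cofactor N (gcd (suc k) N)

    pick : ∀ g → g ≢ 0 → g ∣ N → ΣL (divisors N) (λ d → 𝟙 (cofactor N g ≟ d) * cofactor N d) ≡ g
    pick zero     g≢0′ _                       = ⊥-elim (g≢0′ refl)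
    pick (suc g′) _    (divides zero N≡0)      = ⊥-elim (<-irrefl (sym N≡0) 0<N)
    pick (suc g′) _    (divides (suc q′) N≡qg) = begin
      ΣL (divisors N) (λ d → 𝟙 (cofactor N (suc g′) ≟ d) * cofactor N d)
        ≡⟨ cong (λ c → ΣL (divisors N) (λ d → 𝟙 (c ≟ d) * cofactor N d)) (cofactor-of (suc q′) g′ N≡qg) ⟩
      ΣL (divisors N) (λ d → 𝟙 (suc q′ ≟ d) * cofactor N d)
        ≡⟨ ΣL-pick (divisors N) (cofactor N) (suc q′) (divisors-distinct N) q∈divisors ⟩
      cofactor N (suc q′)
        ≡⟨ cofactor-of (suc g′) q′ N≡gq ⟩
      suc g′
        ∎
      where
      open ≡-Reasoning
      N≡gq : N ≡ suc g′ * suc q′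
      N≡gq = trans N≡qg (*-comm (suc q′) (suc g′))
      q∈divisors : suc q′ ∈ divisors N
      q∈divisors = ∈-filter⁺ (λ d → d ∣? N)
        (∈-applyUpTo⁺ suc (∣⇒≤ ⦃ ≢-nonZero (λ N≡0 → <-irrefl (sym N≡0) 0<N) ⦄ (divides (suc g′) N≡gq)))
        (divides (suc g′) N≡gq)

    class-count : ∀ d → d ∣ N → 0 < d → Σ< (λ k → 𝟙 (class k ≟ d)) N ≡ φ d
    class-count (suc d′) (divides zero N≡0)      _ = ⊥-elim (<-irrefl (sym N≡0) 0<N)
    class-count (suc d′) (divides (suc e′) N≡ed) _ = begin
      Σ< (λ k → 𝟙 (class k ≟ d)) N           ≡⟨ Σ-ext N (λ k _ → 𝟙-⇔ (class k ≟ d) (gcd (suc k) N ≟ e) (to k) (from k)) ⟩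
      Σ< (λ k → 𝟙 (gcd (suc k) N ≟ e)) N     ≡⟨ subst (λ M → Σ< (λ k → 𝟙 (gcd (suc k) M ≟ e)) M ≡ φ d) (sym N≡de) (gcd-count d e′) ⟩
      φ d                                     ∎
      where
      open ≡-Reasoning
      d = suc d′
      e = suc e′
      N≡de : N ≡ d * e
      N≡de = trans N≡ed (*-comm e d)
      cofactor≡⇔ : ∀ g → g ≢ 0 → g ∣ N → (cofactor N g ≡ d → g ≡ e) × (g ≡ e → cofactor N g ≡ d)
      cofactor≡⇔ zero     g≢0′ _ = ⊥-elim (g≢0′ refl)
      cofactor≡⇔ (suc g′) _ (divides q N≡qg) = to-e , from-e
        where
        to-e : cofactor N (suc g′) ≡ d → suc g′ ≡ e
        to-e N/g≡d = *-cancelʳ-≡ (suc g′) e d (begin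
          suc g′ * d   ≡⟨ *-comm (suc g′) d ⟩
          d * suc g′   ≡⟨ cong (_* suc g′) (trans (sym (cofactor-of q g′ N≡qg)) N/g≡d) ⟨
          q * suc g′   ≡⟨ N≡qg ⟨
          N            ≡⟨ N≡ed ⟩
          e * d        ∎)
        from-e : suc g′ ≡ e → cofactor N (suc g′) ≡ d
        from-e g≡e = trans (cofactor-of q g′ N≡qg) (*-cancelʳ-≡ q d e (trans (cong (q *_) (sym g≡e)) (trans (sym N≡qg) N≡de)))
      to : ∀ k → class k ≡ d → gcd (suc k) N ≡ e
      to k = proj₁ (cofactor≡⇔ (gcd (suc k) N) (g≢0 k) (gcd[m,n]∣n (suc k) N))
      from : ∀ k → gcd (suc k) N ≡ e → class k ≡ d
      from k = proj₂ (cofactor≡⇔ (gcd (suc k) N) (g≢0 k) (gcd[m,n]∣n (suc k) N))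

    -- Pillai's identity, with k running over 0, …, N - 1 (gcd(0, N) = N = gcd(N, N)).
    pillai : Σ< (λ k → gcd k N) N ≡ ΣL (divisors N) (λ d → cofactor N d * φ d)
    pillai = begin
      Σ< (λ k → gcd k N) N
        ≡⟨ Σ-rotate (λ k → gcd k N) N (trans (GCD.unique (gcd-GCD N N) GCD.refl) (sym (gcd-identityˡ N))) ⟨
      Σ< (λ k → gcd (suc k) N) N
        ≡⟨ Σ-ext N (λ k _ → sym (pick (gcd (suc k) N) (g≢0 k) (gcd[m,n]∣n (suc k) N))) ⟩
      Σ< (λ k → ΣL (divisors N) (λ d → 𝟙 (class k ≟ d) * cofactor N d)) N
        ≡⟨ ΣL-swap (divisors N) (λ k d → 𝟙 (class k ≟ d) * cofactor N d) N ⟩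
      ΣL (divisors N) (λ d → Σ< (λ k → 𝟙 (class k ≟ d) * cofactor N d) N)
        ≡⟨ ΣL-ext (divisors N) (All.map (λ {d} → per-divisor d) (divisors-positive N)) ⟩
      ΣL (divisors N) (λ d → cofactor N d * φ d)
        ∎
      where
      open ≡-Reasoning
      per-divisor : ∀ d → d ∣ N × 0 < d → Σ< (λ k → 𝟙 (class k ≟ d) * cofactor N d) N ≡ cofactor N d * φ d
      per-divisor d (d∣N , 0<d) = begin
        Σ< (λ k → 𝟙 (class k ≟ d) * cofactor N d) N   ≡⟨ Σ-ext N (λ k _ → *-comm (𝟙 (class k ≟ d)) (cofactor N d)) ⟩
        Σ< (λ k → cofactor N d * 𝟙 (class k ≟ d)) N   ≡⟨ Σ-*ˡ (cofactor N d) (λ k → 𝟙 (class k ≟ d)) N ⟩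
        cofactor N d * Σ< (λ k → 𝟙 (class k ≟ d)) N   ≡⟨ cong (cofactor N d *_) (class-count d d∣N 0<d) ⟩
        cofactor N d * φ d                             ∎

module RationalArithmetic where

  open import Data.Integer as ℤ using (ℤ; +_)
  import Data.Integer.Properties as ℤP
  open import Data.Integer.Tactic.RingSolver using (solve-∀)
  open import Data.Rational as ℚ using (ℚ; _/_; toℚᵘ)
  import Data.Rational.Properties as ℚP
  open import Data.Rational.Unnormalised as ℚᵘ using (mkℚᵘ; *≡*)
  import Data.Rational.Unnormalised.Properties as ℚᵘP
  open import Relation.Binary.PropositionalEquality

  toℚᵘ-/ : ∀ i k → toℚᵘ (i / suc k) ℚᵘ.≃ mkℚᵘ i k
  toℚᵘ-/ i k = ℚP.toℚᵘ-fromℚᵘ (mkℚᵘ i k)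

  +-/1 : ∀ a b → (+ a) / 1 ℚ.+ (+ b) / 1 ≡ (+ (a ℕ.+ b)) / 1
  +-/1 a b = ℚP.toℚᵘ-injective (ℚᵘP.≃-trans (ℚP.toℚᵘ-homo-+ ((+ a) / 1) ((+ b) / 1))
    (ℚᵘP.≃-trans (ℚᵘP.+-cong (toℚᵘ-/ (+ a) 0) (toℚᵘ-/ (+ b) 0))
    (ℚᵘP.≃-trans sum (ℚᵘP.≃-sym (toℚᵘ-/ (+ (a ℕ.+ b)) 0)))))
    where
    cross : ∀ x y → (x ℤ.* + 1 ℤ.+ y ℤ.* + 1) ℤ.* + 1 ≡ (x ℤ.+ y) ℤ.* + 1
    cross = solve-∀
    sum : mkℚᵘ (+ a) 0 ℚᵘ.+ mkℚᵘ (+ b) 0 ℚᵘ.≃ mkℚᵘ (+ (a ℕ.+ b)) 0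
    sum = *≡* (trans (cross (+ a) (+ b)) (cong (ℤ._* + 1) (sym (ℤP.pos-+ a b))))

  *-/1 : ∀ N c k q → N ≡ q ℕ.* suc k → (+ N) / 1 ℚ.* ((+ c) / suc k) ≡ (+ (q ℕ.* c)) / 1
  *-/1 N c k q N≡qk = ℚP.toℚᵘ-injective (ℚᵘP.≃-trans (ℚP.toℚᵘ-homo-* ((+ N) / 1) ((+ c) / suc k))
    (ℚᵘP.≃-trans (ℚᵘP.*-cong (toℚᵘ-/ (+ N) 0) (toℚᵘ-/ (+ c) k))
    (ℚᵘP.≃-trans product (ℚᵘP.≃-sym (toℚᵘ-/ (+ (q ℕ.* c)) 0)))))
    where
    cross : ∀ q s c → ((q ℤ.* s) ℤ.* c) ℤ.* + 1 ≡ (q ℤ.* c) ℤ.* (+ 1 ℤ.* s)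
    cross = solve-∀
    product : mkℚᵘ (+ N) 0 ℚᵘ.* mkℚᵘ (+ c) k ℚᵘ.≃ mkℚᵘ (+ (q ℕ.* c)) 0
    product = *≡* (trans (cong (λ z → (z ℤ.* + c) ℤ.* + 1) (trans (cong +_ N≡qk) (ℤP.pos-* q (suc k))))
                 (trans (cross (+ q) (+ suc k) (+ c)) (cong (ℤ._* (+ 1 ℤ.* + suc k)) (sym (ℤP.pos-* q c)))))

open import Defs
open import Data.Nat using (_∸_)
open import Data.Nat.Primality using (¬prime[0]; ¬prime[1])
open import Data.Nat.Divisibility using (divides; _∣_)
open import Data.Nat.GCD using (gcd)
open import Data.Integer using (+_)
open import Data.Rational as ℚ using (_*_; _/_)
import Data.Rational.Properties as ℚP
open import Data.List using ([]; _∷_; map; foldr)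
open import Data.List.Relation.Unary.All using (All; []; _∷_)
open import Data.Product using (_×_; _,_)
open import Data.Empty using (⊥-elim)
open import Relation.Binary.PropositionalEquality using (_≡_; sym; trans; cong; cong₂; module ≡-Reasoning)
open FiniteSums using (Σ<; ΣL)
open Pillai using (cofactor; cofactor-of; divisors; divisors-positive; pillai)
open RationalArithmetic using (+-/1; *-/1)

scale-φOver-sum : ∀ N D → All (λ d → d ∣ N × 0 ℕ.< d) D →
                  ((+ N) / 1) * foldr ℚ._+_ ℚ.0ℚ (map φOver D) ≡ (+ ΣL D (λ d → cofactor N d ℕ.* φ d)) / 1
scale-φOver-sum N []            []                                 = ℚP.*-zeroʳ ((+ N) / 1)
scale-φOver-sum N (suc k ∷ D)   ((divides q N≡qk , _) ∷ positive) = begin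
  (+ N) / 1 * (φOver (suc k) ℚ.+ rest)                             ≡⟨ ℚP.*-distribˡ-+ ((+ N) / 1) (φOver (suc k)) rest ⟩
  (+ N) / 1 * φOver (suc k) ℚ.+ (+ N) / 1 * rest                   ≡⟨ cong₂ ℚ._+_ head (scale-φOver-sum N D positive) ⟩
  (+ (cofactor N (suc k) ℕ.* φ (suc k))) / 1 ℚ.+ (+ ΣL D (λ d → cofactor N d ℕ.* φ d)) / 1
                                                                   ≡⟨ +-/1 (cofactor N (suc k) ℕ.* φ (suc k)) _ ⟩
  (+ ΣL (suc k ∷ D) (λ d → cofactor N d ℕ.* φ d)) / 1              ∎
  where
  open ≡-Reasoning
  rest = foldr ℚ._+_ ℚ.0ℚ (map φOver D)
  head : (+ N) / 1 * φOver (suc k) ≡ (+ (cofactor N (suc k) ℕ.* φ (suc k))) / 1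
  head = trans (*-/1 N (φ (suc k)) k q N≡qk) (cong (λ c → (+ (c ℕ.* φ (suc k))) / 1) (sym (cofactor-of q k N≡qk)))

mainTheorem1 : (p : ℕ) → Prime p →
    (+ G p) / 1 ≡ ((+ (p ∸ 1)) / 1) * divisorSum (p ∸ 1)
mainTheorem1 zero          isPrime = ⊥-elim (¬prime[0] isPrime)
mainTheorem1 (suc zero)    isPrime = ⊥-elim (¬prime[1] isPrime)
mainTheorem1 (suc (suc m)) isPrime = begin
  (+ G p) / 1                                                 ≡⟨ cong (λ z → (+ z) / 1) (Reduction.G≡Σgcd m isPrime) ⟩
  (+ Σ< (λ k → gcd k n) n) / 1                                ≡⟨ cong (λ z → (+ z) / 1) (pillai n (s≤s z≤n)) ⟩
  (+ ΣL (divisors n) (λ d → cofactor n d ℕ.* φ d)) / 1        ≡⟨ scale-φOver-sum n (divisors n) (divisors-positive n) ⟨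
  ((+ n) / 1) * divisorSum n                                  ∎
  where
  open ≡-Reasoning
  p n : ℕ
  p = suc (suc m)
  n = suc m
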